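{- Let $G$ be a finite prime graph and let $\alpha\notin V(G)$. Then the number of distinct prime graphs $H$ with $V(H)=V(G)\cup\{\alpha\}$ and $H[V(G)]=G$ is exactly $2^{|V(G)|}-2|V(G)|-2$.
   Context: Graphs are simple and undirected; $H[W]$ is the induced subgraph on $W$. A module of a graph is a vertex set $M$ such that each vertex outside $M$ is adjacent to all or none of $M$; trivial modules are $\emptyset$, the whole vertex set, singletons. A graph is prime if it has at least $4$ vertices and all its modules are trivial. -}

module Defs where

open import Data.Nat using (ℕ; suc; _≤_)
open import Data.Bool using (Bool; false)
open import Data.Fin using (Fin; inject₁)
open import Data.Fin.Subset using (Subset; _∈_; _∉_) renaming (⊥ to ∅; ⊤ to full)
open import Data.Fin.Subset using (⁅_⁆)
open import Data.Product using (Σ; ∃; _×_)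
open import Data.Sum using (_⊎_)
open import Relation.Binary.PropositionalEquality using (_≡_)

record Graph (n : ℕ) : Set where
  field
    adj    : Fin n → Fin n → Bool
    sym    : ∀ x y → adj x y ≡ adj y x
    irrefl : ∀ x → adj x x ≡ false
open Graph public

_≈G_ : ∀ {n} → Graph n → Graph n → Set
G ≈G H = ∀ x y → adj G x y ≡ adj H x y

IsModule : ∀ {n} → Graph n → Subset n → Set
IsModule {n} G M = ∀ (v : Fin n) → v ∉ M → ∀ x y → x ∈ M → y ∈ M → adj G v x ≡ adj G v y

Trivial : ∀ {n} → Subset n → Set
Trivial {n} M = M ≡ ∅ ⊎ (M ≡ full ⊎ ∃ λ (x : Fin n) → M ≡ ⁅ x ⁆)

Prime : ∀ {n} → Graph n → Set
Prime {n} G = 4 ≤ n × (∀ M → IsModule G M → Trivial M)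

-- H is a graph on V(G) ∪ {α}, where V(G) = Fin n is embedded via inject₁
-- and α is the new last vertex of Fin (suc n); H[V(G)] = G.
Extends : ∀ {n} → Graph (suc n) → Graph n → Set
Extends {n} H G = ∀ (x y : Fin n) → adj H (inject₁ x) (inject₁ y) ≡ adj G x y

HasExactly : ∀ {m} → (Graph m → Set) → ℕ → Set
HasExactly {m} P k =
  Σ (Fin k → Graph m) λ f →
    (∀ i → P (f i)) ×
    (∀ i j → f i ≈G f j → i ≡ j) ×
    (∀ H → P H → ∃ λ i → H ≈G f i)

-- Let H be G together with a new vertex α whose neighbourhood is N ⊆ V(G). The trace
-- M ∩ V(G) of a module M of H is a module of G, hence trivial, and the only ways in which M
-- can then fail to be trivial are M = V(G), which happens iff N is ∅ or V(G), and
-- M = {x, α}, which happens iff α is a twin of x, i.e. N is N(x) or N[x]. So H is prime iff N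
-- avoids these 2n + 2 exceptional sets. They are pairwise distinct because the prime graph G
-- has no twins and no vertex adjacent to all or to none of the others, so 2^n − 2n − 2 of the
-- 2^n possible neighbourhoods remain.

module Submission where

open import Defs
  hiding (sym)
open import Data.Bool using (Bool; false)
import Data.Bool.Properties as Bool
open import Data.Empty using (⊥; ⊥-elim)
open import Data.Fin using (Fin; zero; suc; inject₁; fromℕ; _≟_)
open import Data.Fin.Properties using (fromℕ≢inject₁)
open import Data.Fin.Relation.Unary.Top using (View; view; ‵fromℕ; ‵inject₁; view-fromℕ; view-inject₁)
open import Data.Fin.Subset
  using (Subset; inside; outside; _∈_; _∉_; ⁅_⁆; ∁; _∪_) renaming (⊥ to ∅; ⊤ to full)
open import Data.Fin.Subset.Properties
  using (∉⊥; ∈⊤; x∈⁅x⁆; x∈⁅y⁆⇒x≡y; x∈∁p⇒x∉p; x∈p⇒x∉∁p; x∉p⇒x∈∁p; x∉∁p⇒x∈p; x∈p∪q⁻; x∈p∪q⁺)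
open import Data.List using (List; []; _∷_; [_]; _++_; map; length; filter; lookup; allFin)
open import Data.List.Properties using (length-++; length-map; length-tabulate)
open import Data.List.Membership.Propositional using () renaming (_∈_ to _∈ₗ_; _∉_ to _∉ₗ_)
open import Data.List.Membership.Propositional.Properties
  using (∈-++⁺ˡ; ∈-++⁺ʳ; ∈-++⁻; ∈-map⁺; ∈-map⁻; ∈-filter⁺; ∈-filter⁻; ∈-lookup; ∈-allFin)
open import Data.List.Membership.Propositional.Properties.WithK using (unique∧set⇒bag)
import Data.List.Membership.DecPropositional as DecMembership
open import Data.List.Relation.Binary.BagAndSetEquality using (∼bag⇒↭)
open import Data.List.Relation.Binary.Permutation.Propositional.Properties using (↭-length)
open import Data.List.Relation.Binary.Subset.Propositional using () renaming (_⊆_ to _⊆ₗ_)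
open import Data.List.Relation.Unary.All as All using ([]; _∷_)
open import Data.List.Relation.Unary.Any as Any using (here; there)
open import Data.List.Relation.Unary.Any.Properties using (lookup-index)
open import Data.List.Relation.Unary.Unique.Propositional using (Unique; []; _∷_)
import Data.List.Relation.Unary.Unique.Propositional.Properties as Unique
open import Data.Nat using (ℕ; zero; suc; _+_; _*_; _^_; _∸_; s≤s)
open import Data.Nat.Properties using (+-identityʳ; +-comm; m+n∸n≡m; ∸-+-assoc; m≤n⇒m≤1+n)
open import Data.Product using (∃; ∃₂; _×_; _,_; proj₁; proj₂)
open import Data.Sum using (inj₁; inj₂; [_,_]′)
open import Data.Vec using (Vec; []; _∷_; here; there; replicate; tabulate; _[_]≔_; _∷ʳ_; initLast)
  renaming (lookup to lookupᵥ)
open import Data.Vec.Properties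
  using (∷-injectiveʳ; ≡-dec; lookup-replicate; lookup∘tabulate; tabulate∘lookup; tabulate-cong;
         lookup∘update; lookup∘update′)
open import Function using (_∘_)
open import Function.Bundles using (mk⇔)
open import Relation.Binary.Definitions using (DecidableEquality)
open import Relation.Binary.PropositionalEquality
  using (_≡_; _≢_; refl; sym; trans; cong; cong₂; subst; module ≡-Reasoning)
open import Relation.Nullary using (¬_; yes; no; ¬?)
open import Relation.Unary using (Decidable)

private
  variable
    n : ℕ

-- Counting duplicate-free lists

module _ {A : Set} (_≟ₐ_ : DecidableEquality A) where
  open DecMembership _≟ₐ_ using (_∈?_)

  length-filter-∉+length : ∀ {xs ys : List A} → Unique xs → Unique ys → ys ⊆ₗ xs →
    length (filter (λ x → ¬? (x ∈? ys)) xs) + length ys ≡ length xs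
  length-filter-∉+length {xs} {ys} !xs !ys ys⊆xs =
    trans (sym (length-++ rest))
      (↭-length (∼bag⇒↭ (unique∧set⇒bag !rest++ys !xs (mk⇔ to from))))
    where
      rest = filter (λ x → ¬? (x ∈? ys)) xs

      !rest++ys : Unique (rest ++ ys)
      !rest++ys = Unique.++⁺ (Unique.filter⁺ _ !xs) !ys
        λ (x∈rest , x∈ys) → proj₂ (∈-filter⁻ _ {xs = xs} x∈rest) x∈ys

      to : ∀ {x} → x ∈ₗ rest ++ ys → x ∈ₗ xs
      to x∈ with ∈-++⁻ rest x∈
      ... | inj₁ x∈rest = proj₁ (∈-filter⁻ _ {xs = xs} x∈rest)
      ... | inj₂ x∈ys   = ys⊆xs x∈ys

      from : ∀ {x} → x ∈ₗ xs → x ∈ₗ rest ++ ys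
      from {x} x∈xs with x ∈? ys
      ... | yes x∈ys = ∈-++⁺ʳ rest x∈ys
      ... | no  x∉ys = ∈-++⁺ˡ (∈-filter⁺ _ x∈xs x∉ys)

Unique⇒lookup-injective : ∀ {A : Set} {xs : List A} → Unique xs →
  ∀ i j → lookup xs i ≡ lookup xs j → i ≡ j
Unique⇒lookup-injective {xs = _ ∷ _} _          zero    zero    _  = refl
Unique⇒lookup-injective {xs = _ ∷ _} (x∉xs ∷ _) zero    (suc j) eq = ⊥-elim (All.lookup x∉xs (∈-lookup j) eq)
Unique⇒lookup-injective {xs = _ ∷ _} (x∉xs ∷ _) (suc i) zero    eq =
  ⊥-elim (All.lookup x∉xs (∈-lookup i) (sym eq))
Unique⇒lookup-injective {xs = _ ∷ _} (_ ∷ !xs)  (suc i) (suc j) eq =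
  cong suc (Unique⇒lookup-injective !xs i j eq)

hasExactly-length : ∀ {A : Set} {m} {P : Graph m → Set} (g : A → Graph m) {xs : List A} →
  Unique xs → (∀ {a} → a ∈ₗ xs → P (g a)) → (∀ {a b} → g a ≈G g b → a ≡ b) →
  (∀ H → P H → ∃ λ a → a ∈ₗ xs × H ≈G g a) → HasExactly P (length xs)
hasExactly-length g {xs} !xs good g-injective complete =
  g ∘ lookup xs ,
  good ∘ ∈-lookup ,
  (λ i j eq → Unique⇒lookup-injective !xs i j (g-injective eq)) ,
  λ H pH → let a , a∈xs , H≈ga = complete H pH in
    Any.index a∈xs , λ x y → trans (H≈ga x y) (cong (λ b → adj (g b) x y) (lookup-index a∈xs))

allSubsets : ∀ n → List (Subset n)
allSubsets zero    = [ [] ]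
allSubsets (suc n) = map (inside ∷_) (allSubsets n) ++ map (outside ∷_) (allSubsets n)

∈-allSubsets : (p : Subset n) → p ∈ₗ allSubsets n
∈-allSubsets []            = here refl
∈-allSubsets (inside ∷ p)  = ∈-++⁺ˡ (∈-map⁺ (inside ∷_) (∈-allSubsets p))
∈-allSubsets (outside ∷ p) = ∈-++⁺ʳ (map (inside ∷_) _) (∈-map⁺ (outside ∷_) (∈-allSubsets p))

allSubsets-unique : ∀ n → Unique (allSubsets n)
allSubsets-unique zero    = [] ∷ []
allSubsets-unique (suc n) =
  Unique.++⁺ (Unique.map⁺ ∷-injectiveʳ (allSubsets-unique n))
             (Unique.map⁺ ∷-injectiveʳ (allSubsets-unique n))
             (λ (p∈ , q∈) → heads-differ p∈ q∈)
  where
    heads-differ : ∀ {p} → p ∈ₗ map (inside ∷_) (allSubsets n) → p ∉ₗ map (outside ∷_) (allSubsets n)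
    heads-differ p∈ q∈ with ∈-map⁻ _ p∈ | ∈-map⁻ _ q∈
    ... | _ , _ , refl | _ , _ , ()

length-allSubsets : ∀ n → length (allSubsets n) ≡ 2 ^ n
length-allSubsets zero    = refl
length-allSubsets (suc n) = begin
  length (map (inside ∷_) (allSubsets n) ++ map (outside ∷_) (allSubsets n))
    ≡⟨ length-++ (map (inside ∷_) (allSubsets n)) ⟩
  length (map (inside ∷_) (allSubsets n)) + length (map (outside ∷_) (allSubsets n))
    ≡⟨ cong₂ _+_ (length-map _ (allSubsets n)) (length-map _ (allSubsets n)) ⟩
  length (allSubsets n) + length (allSubsets n)
    ≡⟨ cong₂ _+_ (length-allSubsets n) (trans (length-allSubsets n) (sym (+-identityʳ (2 ^ n)))) ⟩
  2 ^ suc n ∎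
  where open ≡-Reasoning

≗-lookup⇒≡ : ∀ {A : Set} {u v : Vec A n} → (∀ i → lookupᵥ u i ≡ lookupᵥ v i) → u ≡ v
≗-lookup⇒≡ {u = u} {v} eq = begin
  u                   ≡⟨ sym (tabulate∘lookup u) ⟩
  tabulate (lookupᵥ u) ≡⟨ tabulate-cong eq ⟩
  tabulate (lookupᵥ v) ≡⟨ tabulate∘lookup v ⟩
  v                   ∎
  where open ≡-Reasoning

replicate-∷ʳ : ∀ {A : Set} (a : A) n → replicate n a ∷ʳ a ≡ replicate (suc n) a
replicate-∷ʳ a zero    = refl
replicate-∷ʳ a (suc n) = cong (a ∷_) (replicate-∷ʳ a n)

⁅⁆-∷ʳ-outside : (x : Fin n) → ⁅ x ⁆ ∷ʳ outside ≡ ⁅ inject₁ x ⁆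
⁅⁆-∷ʳ-outside {suc n} zero    = cong (inside ∷_) (replicate-∷ʳ outside n)
⁅⁆-∷ʳ-outside         (suc x) = cong (outside ∷_) (⁅⁆-∷ʳ-outside x)

∅-∷ʳ-inside : ∀ n → ∅ ∷ʳ inside ≡ ⁅ fromℕ n ⁆
∅-∷ʳ-inside zero    = refl
∅-∷ʳ-inside (suc n) = cong (outside ∷_) (∅-∷ʳ-inside n)

inject₁∈∷ʳ : ∀ {p : Subset n} {x b} → x ∈ p → inject₁ x ∈ p ∷ʳ b
inject₁∈∷ʳ here        = here
inject₁∈∷ʳ (there x∈p) = there (inject₁∈∷ʳ x∈p)

inject₁∈∷ʳ⁻ : ∀ {p : Subset n} {x b} → inject₁ x ∈ p ∷ʳ b → x ∈ p
inject₁∈∷ʳ⁻ {p = _ ∷ _} {zero}  here   = here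
inject₁∈∷ʳ⁻ {p = _ ∷ _} {suc x} (there x∈) = there (inject₁∈∷ʳ⁻ x∈)

fromℕ∈∷ʳ : (p : Subset n) → fromℕ n ∈ p ∷ʳ inside
fromℕ∈∷ʳ []      = here
fromℕ∈∷ʳ (_ ∷ p) = there (fromℕ∈∷ʳ p)

fromℕ∉∷ʳ : (p : Subset n) → fromℕ n ∉ p ∷ʳ outside
fromℕ∉∷ʳ (_ ∷ p) (there α∈) = fromℕ∉∷ʳ p α∈

nontrivial : ∀ {M : Subset n} {x y z} → x ∈ M → y ∈ M → x ≢ y → z ∉ M → ¬ Trivial M
nontrivial x∈M _   _   _   (inj₁ refl)              = ∉⊥ x∈M
nontrivial _   _   _   z∉M (inj₂ (inj₁ refl))       = z∉M ∈⊤
nontrivial x∈M y∈M x≢y _   (inj₂ (inj₂ (w , refl))) =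
  x≢y (trans (x∈⁅y⁆⇒x≡y w x∈M) (sym (x∈⁅y⁆⇒x≡y w y∈M)))

third : ∀ {m} (x y : Fin (suc (suc (suc m)))) → ∃ λ z → z ≢ x × z ≢ y
third zero          zero          = suc zero       , (λ ()) , (λ ())
third zero          (suc zero)    = suc (suc zero) , (λ ()) , (λ ())
third zero          (suc (suc _)) = suc zero       , (λ ()) , (λ ())
third (suc zero)    zero          = suc (suc zero) , (λ ()) , (λ ())
third (suc zero)    (suc zero)    = zero           , (λ ()) , (λ ())
third (suc zero)    (suc (suc _)) = zero           , (λ ()) , (λ ())
third (suc (suc _)) zero          = suc zero       , (λ ()) , (λ ())
third (suc (suc _)) (suc _)       = zero           , (λ ()) , (λ ())

pair-nontrivial : ∀ {m} {x y : Fin (suc (suc (suc m)))} → x ≢ y → ¬ Trivial (⁅ x ⁆ ∪ ⁅ y ⁆)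
pair-nontrivial {x = x} {y} x≢y with third x y
... | z , z≢x , z≢y = nontrivial (x∈p∪q⁺ (inj₁ (x∈⁅x⁆ x))) (x∈p∪q⁺ (inj₂ (x∈⁅x⁆ y))) x≢y
                         ([ z≢x ∘ x∈⁅y⁆⇒x≡y x , z≢y ∘ x∈⁅y⁆⇒x≡y y ]′ ∘ x∈p∪q⁻ ⁅ x ⁆ ⁅ y ⁆)

co-singleton-nontrivial : ∀ {m} (x : Fin (suc (suc (suc m)))) → ¬ Trivial (∁ ⁅ x ⁆)
co-singleton-nontrivial x with third x x
... | y₁ , y₁≢x , _ with third x y₁
...   | y₂ , y₂≢x , y₂≢y₁ =
  nontrivial (x∉p⇒x∈∁p (y₁≢x ∘ x∈⁅y⁆⇒x≡y x)) (x∉p⇒x∈∁p (y₂≢x ∘ x∈⁅y⁆⇒x≡y x)) (y₂≢y₁ ∘ sym)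
             (x∈p⇒x∉∁p (x∈⁅x⁆ x))

-- Modules of prime graphs

Prime-resp-≈G : ∀ {G H : Graph n} → G ≈G H → Prime G → Prime H
Prime-resp-≈G G≈H (4≤n , prime) = 4≤n , λ M mod → prime M λ v v∉M x y x∈M y∈M →
  trans (G≈H v x) (trans (mod v v∉M x y x∈M y∈M) (sym (G≈H v y)))

prime⇒twin-free : ∀ {G : Graph n} {x y} → Prime G →
  (∀ z → z ≢ x → z ≢ y → adj G x z ≡ adj G y z) → x ≡ y
prime⇒twin-free {G = G} {x} {y} (s≤s (s≤s (s≤s _)) , prime) twins with x ≟ y
... | yes x≡y = x≡y
... | no  x≢y = ⊥-elim (pair-nontrivial x≢y (prime (⁅ x ⁆ ∪ ⁅ y ⁆) pair-module))
  where
    seen-as-x : ∀ {v a} → v ∉ ⁅ x ⁆ ∪ ⁅ y ⁆ → a ∈ ⁅ x ⁆ ∪ ⁅ y ⁆ → adj G v a ≡ adj G x v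
    seen-as-x {v} v∉ a∈ with x∈p∪q⁻ ⁅ x ⁆ ⁅ y ⁆ a∈
    ... | inj₁ a∈x rewrite x∈⁅y⁆⇒x≡y x a∈x = Graph.sym G v x
    ... | inj₂ a∈y rewrite x∈⁅y⁆⇒x≡y y a∈y =
      trans (Graph.sym G v y)
            (sym (twins v (λ { refl → v∉ (x∈p∪q⁺ (inj₁ (x∈⁅x⁆ x))) })
                          (λ { refl → v∉ (x∈p∪q⁺ (inj₂ (x∈⁅x⁆ y))) })))

    pair-module : IsModule G (⁅ x ⁆ ∪ ⁅ y ⁆)
    pair-module v v∉ a b a∈ b∈ = trans (seen-as-x v∉ a∈) (sym (seen-as-x v∉ b∈))

prime⇒no-constant-row : ∀ {G : Graph n} {x c} → Prime G → ¬ (∀ z → z ≢ x → adj G x z ≡ c)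
prime⇒no-constant-row {G = G} {x} {c} (s≤s (s≤s (s≤s _)) , prime) row =
  co-singleton-nontrivial x (prime (∁ ⁅ x ⁆) co-singleton-module)
  where
    seen-as-c : ∀ {v a} → v ∉ ∁ ⁅ x ⁆ → a ∈ ∁ ⁅ x ⁆ → adj G v a ≡ c
    seen-as-c {v} {a} v∉ a∈ rewrite x∈⁅y⁆⇒x≡y x (x∉∁p⇒x∈p v∉) =
      row a λ { refl → x∈∁p⇒x∉p a∈ (x∈⁅x⁆ x) }

    co-singleton-module : IsModule G (∁ ⁅ x ⁆)
    co-singleton-module v v∉ a b a∈ b∈ = trans (seen-as-c v∉ a∈) (sym (seen-as-c v∉ b∈))

-- A new vertex is a twin of x exactly when its neighbourhood is twinNbhd G x b: the open
-- neighbourhood N(x) for b = outside, the closed one N[x] for b = inside.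
twinNbhd : Graph n → Fin n → Bool → Subset n
twinNbhd G x b = tabulate (adj G x) [ x ]≔ b

twinNbhd-self : ∀ (G : Graph n) x b → lookupᵥ (twinNbhd G x b) x ≡ b
twinNbhd-self G x b = lookup∘update x (tabulate (adj G x)) b

twinNbhd-other : ∀ (G : Graph n) {x z} b → z ≢ x → lookupᵥ (twinNbhd G x b) z ≡ adj G x z
twinNbhd-other G {x} {z} b z≢x =
  trans (lookup∘update′ z≢x (tabulate (adj G x)) b) (lookup∘tabulate (adj G x) z)

twinNbhd-≡⇒twins : ∀ (G : Graph n) {x y} b c → twinNbhd G x b ≡ twinNbhd G y c →
  ∀ z → z ≢ x → z ≢ y → adj G x z ≡ adj G y z
twinNbhd-≡⇒twins G b c eq z z≢x z≢y =
  trans (sym (twinNbhd-other G b z≢x)) (trans (cong (λ N → lookupᵥ N z) eq) (twinNbhd-other G c z≢y))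

twinNbhd-injective : ∀ {G : Graph n} {x y b c} → Prime G →
  twinNbhd G x b ≡ twinNbhd G y c → x ≡ y × b ≡ c
twinNbhd-injective {G = G} {x} {b = b} {c} prime eq
  with refl ← prime⇒twin-free {G = G} prime (twinNbhd-≡⇒twins G b c eq) =
  refl , trans (sym (twinNbhd-self G x b)) (trans (cong (λ N → lookupᵥ N x) eq) (twinNbhd-self G x c))

twinNbhd-nonconstant : ∀ {G : Graph n} {x b c} → Prime G → twinNbhd G x b ≢ replicate n c
twinNbhd-nonconstant {G = G} {x} {b} {c} prime eq = prime⇒no-constant-row {G = G} prime λ z z≢x →
  trans (sym (twinNbhd-other G b z≢x)) (trans (cong (λ N → lookupᵥ N z) eq) (lookup-replicate z c))

-- One-vertex extensions

module _ (G : Graph n) (N : Subset n) where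

  private
    extendAdj : ∀ {i j : Fin (suc n)} → View i → View j → Bool
    extendAdj (‵inject₁ x) (‵inject₁ y) = adj G x y
    extendAdj (‵inject₁ x) ‵fromℕ       = lookupᵥ N x
    extendAdj ‵fromℕ       (‵inject₁ y) = lookupᵥ N y
    extendAdj ‵fromℕ       ‵fromℕ       = false

    extendAdj-sym : ∀ {i j : Fin (suc n)} (v : View i) (w : View j) → extendAdj v w ≡ extendAdj w v
    extendAdj-sym (‵inject₁ x) (‵inject₁ y) = Graph.sym G x y
    extendAdj-sym (‵inject₁ x) ‵fromℕ       = refl
    extendAdj-sym ‵fromℕ       (‵inject₁ y) = refl
    extendAdj-sym ‵fromℕ       ‵fromℕ       = refl

    extendAdj-irrefl : ∀ {i : Fin (suc n)} (v : View i) → extendAdj v v ≡ false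
    extendAdj-irrefl (‵inject₁ x) = irrefl G x
    extendAdj-irrefl ‵fromℕ       = refl

  extend : Graph (suc n)
  extend = record
    { adj    = λ i j → extendAdj (view i) (view j)
    ; sym    = λ i j → extendAdj-sym (view i) (view j)
    ; irrefl = λ i → extendAdj-irrefl (view i)
    }

  extend-extends : Extends extend G
  extend-extends x y rewrite view-inject₁ x | view-inject₁ y = refl

  extend-fromℕ : ∀ x → adj extend (fromℕ n) (inject₁ x) ≡ lookupᵥ N x
  extend-fromℕ x rewrite view-fromℕ n | view-inject₁ x = refl

lastNbhd : Graph (suc n) → Subset n
lastNbhd H = tabulate (λ x → adj H (fromℕ _) (inject₁ x))

extends⇒≈extend : ∀ {H : Graph (suc n)} {G} → Extends H G → H ≈G extend G (lastNbhd H)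
extends⇒≈extend {H = H} H⊇G i j with view i | view j
... | ‵inject₁ x | ‵inject₁ y = H⊇G x y
... | ‵inject₁ x | ‵fromℕ     = trans (Graph.sym H _ _) (sym (lookup∘tabulate _ x))
... | ‵fromℕ     | ‵inject₁ y = sym (lookup∘tabulate _ y)
... | ‵fromℕ     | ‵fromℕ     = irrefl H _

extend-injective : ∀ {G : Graph n} {N N′} → extend G N ≈G extend G N′ → N ≡ N′
extend-injective {G = G} {N} {N′} eq = ≗-lookup⇒≡ λ x →
  trans (sym (extend-fromℕ G N x)) (trans (eq (fromℕ _) (inject₁ x)) (extend-fromℕ G N′ x))

module _ {G : Graph n} {N : Subset n} where

  private
    H = extend G N
    α = fromℕ n

  restrict-module : ∀ {M b} → IsModule H (M ∷ʳ b) → IsModule G M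
  restrict-module mod v v∉M x y x∈M y∈M =
    trans (sym (extend-extends G N v x))
          (trans (mod (inject₁ v) (v∉M ∘ inject₁∈∷ʳ⁻) (inject₁ x) (inject₁ y)
                      (inject₁∈∷ʳ x∈M) (inject₁∈∷ʳ y∈M))
                 (extend-extends G N v y))

  old-vertices-module⇒constant : IsModule H (full ∷ʳ outside) → (x₀ : Fin n) →
    N ≡ replicate n (lookupᵥ N x₀)
  old-vertices-module⇒constant mod x₀ = ≗-lookup⇒≡ λ x →
    trans (sym (extend-fromℕ G N x))
          (trans (mod α (fromℕ∉∷ʳ full) (inject₁ x) (inject₁ x₀) (inject₁∈∷ʳ ∈⊤) (inject₁∈∷ʳ ∈⊤))
                 (trans (extend-fromℕ G N x₀) (sym (lookup-replicate x _))))

  pair-module⇒twinNbhd : ∀ {x} → IsModule H (⁅ x ⁆ ∷ʳ inside) → N ≡ twinNbhd G x (lookupᵥ N x)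
  pair-module⇒twinNbhd {x} mod = ≗-lookup⇒≡ agree
    where
      agree : ∀ y → lookupᵥ N y ≡ lookupᵥ (twinNbhd G x (lookupᵥ N x)) y
      agree y with y ≟ x
      ... | yes refl = sym (twinNbhd-self G y _)
      ... | no  y≢x  = begin
        lookupᵥ N y                   ≡⟨ extend-fromℕ G N y ⟨
        adj H α (inject₁ y)           ≡⟨ Graph.sym H α (inject₁ y) ⟩
        adj H (inject₁ y) α           ≡⟨ mod (inject₁ y) (y≢x ∘ x∈⁅y⁆⇒x≡y x ∘ inject₁∈∷ʳ⁻) α (inject₁ x)
                                             (fromℕ∈∷ʳ ⁅ x ⁆) (inject₁∈∷ʳ (x∈⁅x⁆ x)) ⟩
        adj H (inject₁ y) (inject₁ x) ≡⟨ extend-extends G N y x ⟩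
        adj G y x                     ≡⟨ Graph.sym G y x ⟩
        adj G x y                     ≡⟨ twinNbhd-other G _ y≢x ⟨
        lookupᵥ (twinNbhd G x (lookupᵥ N x)) y ∎
        where open ≡-Reasoning

module _ {G : Graph n} where

  -- The helpers receive the View of a vertex instead of abstracting over view v: with-abstraction
  -- would leave view (fromℕ n) stuck in the goal, out of reach of extend-fromℕ.
  private
    α = fromℕ n

    seen-from-new : ∀ {c a} → View a → a ∈ full ∷ʳ outside → adj (extend G (replicate n c)) α a ≡ c
    seen-from-new {c} (‵inject₁ x) _  = trans (extend-fromℕ G _ x) (lookup-replicate x c)
    seen-from-new     ‵fromℕ       a∈ = ⊥-elim (fromℕ∉∷ʳ full a∈)

    seen-as-twin : ∀ {x b z a} → View a → z ≢ x → a ∈ ⁅ x ⁆ ∷ʳ inside →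
      adj (extend G (twinNbhd G x b)) (inject₁ z) a ≡ adj G x z
    seen-as-twin {x} {z = z} (‵inject₁ y) _ a∈ with refl ← x∈⁅y⁆⇒x≡y x (inject₁∈∷ʳ⁻ a∈) =
      trans (extend-extends G _ z x) (Graph.sym G z x)
    seen-as-twin {x} {b} {z} ‵fromℕ z≢x _ =
      trans (Graph.sym (extend G _) (inject₁ z) α) (trans (extend-fromℕ G _ z) (twinNbhd-other G b z≢x))

    constant-module : ∀ {c v} → View v → v ∉ full ∷ʳ outside →
      ∀ a a′ → a ∈ full ∷ʳ outside → a′ ∈ full ∷ʳ outside →
      adj (extend G (replicate n c)) v a ≡ adj (extend G (replicate n c)) v a′
    constant-module (‵inject₁ _) v∉ _ _ _  _   = ⊥-elim (v∉ (inject₁∈∷ʳ ∈⊤))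
    constant-module ‵fromℕ       _  a a′ a∈ a′∈ =
      trans (seen-from-new (view a) a∈) (sym (seen-from-new (view a′) a′∈))

    twin-module : ∀ {x b v} → View v → v ∉ ⁅ x ⁆ ∷ʳ inside →
      ∀ a a′ → a ∈ ⁅ x ⁆ ∷ʳ inside → a′ ∈ ⁅ x ⁆ ∷ʳ inside →
      adj (extend G (twinNbhd G x b)) v a ≡ adj (extend G (twinNbhd G x b)) v a′
    twin-module {x} ‵fromℕ         v∉ _ _  _  _   = ⊥-elim (v∉ (fromℕ∈∷ʳ ⁅ x ⁆))
    twin-module {x} (‵inject₁ z) v∉ a a′ a∈ a′∈ =
      trans (seen-as-twin (view a) z≢x a∈) (sym (seen-as-twin (view a′) z≢x a′∈))
      where
        z≢x : z ≢ x
        z≢x refl = v∉ (inject₁∈∷ʳ (x∈⁅x⁆ x))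

  constant⇒old-vertices-module : ∀ c → IsModule (extend G (replicate n c)) (full ∷ʳ outside)
  constant⇒old-vertices-module c v = constant-module (view v)

  twinNbhd⇒pair-module : ∀ x b → IsModule (extend G (twinNbhd G x b)) (⁅ x ⁆ ∷ʳ inside)
  twinNbhd⇒pair-module x b v = twin-module (view v)

data Exceptional (G : Graph n) : Subset n → Set where
  constant : ∀ c → Exceptional G (replicate n c)
  twin     : ∀ x b → Exceptional G (twinNbhd G x b)

trivial-∷ʳ : ∀ {G : Graph n} {N M b} → ¬ Exceptional G N → (x₀ : Fin n) →
  IsModule (extend G N) (M ∷ʳ b) → Trivial M → Trivial (M ∷ʳ b)
trivial-∷ʳ {n = n} {b = outside} _ _ _ (inj₁ refl) = inj₁ (replicate-∷ʳ outside n)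
trivial-∷ʳ {n = n} {b = inside}  _ _ _ (inj₁ refl) = inj₂ (inj₂ (fromℕ n , ∅-∷ʳ-inside n))
trivial-∷ʳ {n = n} {b = inside}  _ _ _ (inj₂ (inj₁ refl)) = inj₂ (inj₁ (replicate-∷ʳ inside n))
trivial-∷ʳ {G = G} {b = outside} ¬exc x₀ mod (inj₂ (inj₁ refl)) =
  ⊥-elim (¬exc (subst (Exceptional G) (sym (old-vertices-module⇒constant mod x₀)) (constant _)))
trivial-∷ʳ {b = outside} _ _ _ (inj₂ (inj₂ (x , refl))) = inj₂ (inj₂ (inject₁ x , ⁅⁆-∷ʳ-outside x))
trivial-∷ʳ {G = G} {b = inside} ¬exc _ mod (inj₂ (inj₂ (x , refl))) =
  ⊥-elim (¬exc (subst (Exceptional G) (sym (pair-module⇒twinNbhd mod)) (twin x _)))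

extend-prime : ∀ {G : Graph n} {N} → Prime G → ¬ Exceptional G N → Prime (extend G N)
extend-prime {G = G} {N} (4≤n@(s≤s _) , prime) ¬exc = m≤n⇒m≤1+n 4≤n , trivial
  where
    trivial : ∀ M → IsModule (extend G N) M → Trivial M
    trivial M mod with initLast M
    ... | M′ , b , refl = trivial-∷ʳ ¬exc zero mod (prime M′ (restrict-module mod))

extend-prime⇒¬exceptional : ∀ {G : Graph n} {N} → Prime (extend G N) → ¬ Exceptional G N
extend-prime⇒¬exceptional (s≤s (s≤s (s≤s (s≤s _))) , prime) (constant c) =
  nontrivial (inject₁∈∷ʳ (∈⊤ {x = zero})) (inject₁∈∷ʳ (∈⊤ {x = suc zero})) (λ ()) (fromℕ∉∷ʳ full)
             (prime (full ∷ʳ outside) (constant⇒old-vertices-module c))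
extend-prime⇒¬exceptional (s≤s (s≤s (s≤s (s≤s _))) , prime) (twin x b) with third x x
... | z , z≢x , _ =
  nontrivial (inject₁∈∷ʳ (x∈⁅x⁆ x)) (fromℕ∈∷ʳ ⁅ x ⁆) (fromℕ≢inject₁ ∘ sym)
             (z≢x ∘ x∈⁅y⁆⇒x≡y x ∘ inject₁∈∷ʳ⁻ {x = z})
             (prime (⁅ x ⁆ ∷ʳ inside) (twinNbhd⇒pair-module x b))

-- Counting the prime extensions

twinNbhds : Graph n → Bool → List (Subset n)
twinNbhds {n} G b = map (λ x → twinNbhd G x b) (allFin n)

exceptional : Graph n → List (Subset n)
exceptional G = ∅ ∷ full ∷ twinNbhds G outside ++ twinNbhds G inside

∈-exceptional⁺ : ∀ {G : Graph n} {N} → Exceptional G N → N ∈ₗ exceptional G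
∈-exceptional⁺ (constant outside) = here refl
∈-exceptional⁺ (constant inside)  = there (here refl)
∈-exceptional⁺ {G = G} (twin x b@outside) =
  there (there (∈-++⁺ˡ (∈-map⁺ (λ y → twinNbhd G y b) (∈-allFin x))))
∈-exceptional⁺ {G = G} (twin x b@inside)  =
  there (there (∈-++⁺ʳ (twinNbhds G outside) (∈-map⁺ (λ y → twinNbhd G y b) (∈-allFin x))))

∈-twinNbhds⁻ : ∀ {G : Graph n} {N} → N ∈ₗ twinNbhds G outside ++ twinNbhds G inside →
  ∃₂ λ x b → N ≡ twinNbhd G x b
∈-twinNbhds⁻ {G = G} N∈ with ∈-++⁻ (twinNbhds G outside) N∈
... | inj₁ N∈ᵒ = let x , _ , eq = ∈-map⁻ _ N∈ᵒ in x , outside , eq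
... | inj₂ N∈ⁱ = let x , _ , eq = ∈-map⁻ _ N∈ⁱ in x , inside , eq

∈-exceptional⁻ : ∀ {G : Graph n} {N} → N ∈ₗ exceptional G → Exceptional G N
∈-exceptional⁻ (here refl)         = constant outside
∈-exceptional⁻ (there (here refl)) = constant inside
∈-exceptional⁻ {G = G} (there (there N∈)) with ∈-twinNbhds⁻ {G = G} N∈
... | x , b , refl = twin x b

exceptional-unique : ∀ {G : Graph n} → Prime G → Unique (exceptional G)
exceptional-unique {n} {G} prime@(s≤s _ , _) =
  (∅≢full ∷ All.tabulate (constant≢twin outside)) ∷
  All.tabulate (constant≢twin inside) ∷
  Unique.++⁺ (twinNbhds-unique outside) (twinNbhds-unique inside) disjoint
  where
    ∅≢full : ∅ ≢ full
    ∅≢full ()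

    constant≢twin : ∀ c {N} → N ∈ₗ twinNbhds G outside ++ twinNbhds G inside → replicate n c ≢ N
    constant≢twin c N∈ eq with ∈-twinNbhds⁻ {G = G} N∈
    ... | x , b , refl = twinNbhd-nonconstant {G = G} prime (sym eq)

    twinNbhds-unique : ∀ b → Unique (twinNbhds G b)
    twinNbhds-unique b = Unique.map⁺ (proj₁ ∘ twinNbhd-injective {G = G} prime) (Unique.allFin⁺ n)

    disjoint : ∀ {N} → N ∈ₗ twinNbhds G outside × N ∈ₗ twinNbhds G inside → ⊥
    disjoint (N∈ᵒ , N∈ⁱ) with ∈-map⁻ _ {xs = allFin n} N∈ᵒ | ∈-map⁻ _ {xs = allFin n} N∈ⁱ
    ... | x , _ , refl | y , _ , eq with () ← proj₂ (twinNbhd-injective {G = G} {x} {y} prime eq)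

length-exceptional : ∀ (G : Graph n) → length (exceptional G) ≡ 2 * n + 2
length-exceptional {n} G = begin
  2 + length (twinNbhds G outside ++ twinNbhds G inside)
    ≡⟨ cong (2 +_) (length-++ (twinNbhds G outside)) ⟩
  2 + (length (twinNbhds G outside) + length (twinNbhds G inside))
    ≡⟨ cong (2 +_) (cong₂ _+_ (length-twinNbhds outside)
                              (trans (length-twinNbhds inside) (sym (+-identityʳ n)))) ⟩
  2 + 2 * n
    ≡⟨ +-comm 2 (2 * n) ⟩
  2 * n + 2 ∎
  where
    open ≡-Reasoning
    length-twinNbhds : ∀ b → length (twinNbhds G b) ≡ n
    length-twinNbhds b = trans (length-map _ (allFin n)) (length-tabulate (λ x → x))

_≟ₛ_ : DecidableEquality (Subset n)
_≟ₛ_ = ≡-dec Bool._≟_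

module _ (G : Graph n) where
  open DecMembership (_≟ₛ_ {n}) using (_∈?_)

  nonExceptional? : Decidable (_∉ₗ exceptional G)
  nonExceptional? N = ¬? (N ∈? exceptional G)

  nonExceptional : List (Subset n)
  nonExceptional = filter nonExceptional? (allSubsets n)

module _ {G : Graph n} where

  ∈-nonExceptional⁺ : ∀ {N} → ¬ Exceptional G N → N ∈ₗ nonExceptional G
  ∈-nonExceptional⁺ {N} ¬exc = ∈-filter⁺ (nonExceptional? G) (∈-allSubsets N) (¬exc ∘ ∈-exceptional⁻)

  ∈-nonExceptional⁻ : ∀ {N} → N ∈ₗ nonExceptional G → ¬ Exceptional G N
  ∈-nonExceptional⁻ N∈ = proj₂ (∈-filter⁻ (nonExceptional? G) {xs = allSubsets n} N∈) ∘ ∈-exceptional⁺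

  nonExceptional-unique : Unique (nonExceptional G)
  nonExceptional-unique = Unique.filter⁺ (nonExceptional? G) (allSubsets-unique n)

length-nonExceptional : ∀ {G : Graph n} → Prime G → length (nonExceptional G) ≡ 2 ^ n ∸ 2 * n ∸ 2
length-nonExceptional {n} {G} prime = begin
  length (nonExceptional G)                              ≡⟨ m+n∸n≡m _ (length (exceptional G)) ⟨
  length (nonExceptional G) + length (exceptional G) ∸ length (exceptional G)
    ≡⟨ cong₂ _∸_ (length-filter-∉+length _≟ₛ_ (allSubsets-unique n) (exceptional-unique {G = G} prime)
                                          (λ {N} _ → ∈-allSubsets N))
                 (length-exceptional G) ⟩
  length (allSubsets n) ∸ (2 * n + 2)                    ≡⟨ cong (_∸ (2 * n + 2)) (length-allSubsets n) ⟩
  2 ^ n ∸ (2 * n + 2)                                    ≡⟨ ∸-+-assoc (2 ^ n) (2 * n) 2 ⟨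
  2 ^ n ∸ 2 * n ∸ 2                                      ∎
  where open ≡-Reasoning

lemma24 : (n : ℕ) (G : Graph n) → Prime G →
    HasExactly (λ (H : Graph (suc n)) → Extends H G × Prime H) (2 ^ n ∸ 2 * n ∸ 2)
lemma24 n G prime =
  subst (HasExactly _) (length-nonExceptional {G = G} prime)
    (hasExactly-length (extend G) (nonExceptional-unique {G = G}) good extend-injective complete)
  where
    good : ∀ {N} → N ∈ₗ nonExceptional G → Extends (extend G N) G × Prime (extend G N)
    good N∈ = extend-extends G _ , extend-prime prime (∈-nonExceptional⁻ N∈)

    complete : ∀ H → Extends H G × Prime H → ∃ λ N → N ∈ₗ nonExceptional G × H ≈G extend G N
    complete H (H⊇G , primeH) =
      N , ∈-nonExceptional⁺ {G = G} (extend-prime⇒¬exceptional prime-extend) , H≈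
      where
        N = lastNbhd H

        H≈ : H ≈G extend G N
        H≈ = extends⇒≈extend {H = H} H⊇G

        prime-extend : Prime (extend G N)
        prime-extend = Prime-resp-≈G {G = H} {extend G N} H≈ primeH
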